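{- Let $\mathcal{N}$ be a temporal phylogenetic network on $X$. Then $\mathcal{N}$ is tree-based if and only if $\mathcal{N}$ satisfies the antichain-to-leaf property.
   Context: A phylogenetic network $\mathcal{N}$ on a non-empty finite set $X$ is a rooted acyclic digraph with no parallel edges such that: the unique root has out-degree two; every vertex of out-degree zero has in-degree one, and the set of out-degree-zero vertices (the leaves) is exactly $X$; every other vertex has either in-degree one and out-degree two, or in-degree two and out-degree one (if $|X|=1$, $\mathcal{N}$ may also be the single vertex in $X$). Vertices of in-degree two are reticulations; edges directed into reticulations are reticulation edges, all other edges are tree edges. $\mathcal{N}=(V,E)$ is tree-based if it has a rooted spanning tree $(V,E')$, $E'\subseteq E$, all of whose leaves lie in $X$. $\mathcal{N}$ is temporal if there is a map $\lambda:V\to\mathbb{R}$ with $\lambda(u)<\lambda(v)$ for every tree edge $(u,v)$ and $\lambda(u)=\lambda(v)$ for every reticulation edge $(u,v)$. An antichain is a set $S$ of vertices such that for all distinct $u,v\in S$ there is no directed path from $u$ to $v$. $\mathcal{N}$ satisfies the antichain-to-leaf property if for every antichain of $k$ vertices there exist $k$ vertex disjoint directed paths from the elements of the antichain to leaves of $\mathcal{N}$.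
   Formalization: The temporal map λ takes values in ℚ instead of ℝ. -}

module Defs where

open import Data.Nat using (ℕ; zero; suc)
open import Data.Bool using (Bool; true; false)
open import Data.Fin using (Fin)
open import Data.List using (List; []; _∷_; map; allFin)
open import Data.List.Membership.Propositional using (_∈_)
open import Data.Product using (Σ; ∃; _×_; _,_)
open import Data.Sum using (_⊎_)
open import Data.Unit using (⊤)
open import Data.Empty using (⊥)
open import Data.Rational using (ℚ; _<_)
open import Relation.Nullary using (¬_)
open import Relation.Binary.PropositionalEquality using (_≡_; _≢_)
open import Relation.Binary.Construct.Closure.Transitive using (TransClosure)
open import Relation.Binary.Construct.Closure.ReflexiveTransitive using (Star)
open import Function.Definitions using (Injective)

-- A finite digraph on vertex set Fin n, given by a Boolean adjacency
-- relation (so there are no parallel edges by construction).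
Digraph : ℕ → Set
Digraph n = Fin n → Fin n → Bool

module _ {n : ℕ} where

  Edge : Digraph n → Fin n → Fin n → Set
  Edge E u v = E u v ≡ true

  countTrue : List Bool → ℕ
  countTrue []           = zero
  countTrue (true  ∷ bs) = suc (countTrue bs)
  countTrue (false ∷ bs) = countTrue bs

  indeg : Digraph n → Fin n → ℕ
  indeg E v = countTrue (map (λ u → E u v) (allFin n))

  outdeg : Digraph n → Fin n → ℕ
  outdeg E u = countTrue (map (λ v → E u v) (allFin n))

  Reach : Digraph n → Fin n → Fin n → Set
  Reach E = Star (Edge E)

  Acyclic : Digraph n → Set
  Acyclic E = ∀ v → ¬ TransClosure (Edge E) v v

  -- A phylogenetic network (with leaf set X = vertices of out-degree 0).
  IsPhyloNetwork : Digraph n → Set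
  IsPhyloNetwork E =
    (n ≡ 1 × (∀ u v → E u v ≡ false))
    ⊎ (Acyclic E
       × Σ (Fin n) (λ r →
           indeg E r ≡ 0 × outdeg E r ≡ 2
           × (∀ v → indeg E v ≡ 0 → v ≡ r)
           × (∀ v → (indeg E v ≡ 0 × outdeg E v ≡ 2)
                  ⊎ (indeg E v ≡ 1 × outdeg E v ≡ 0)
                  ⊎ (indeg E v ≡ 1 × outdeg E v ≡ 2)
                  ⊎ (indeg E v ≡ 2 × outdeg E v ≡ 1))))

  IsLeaf : Digraph n → Fin n → Set
  IsLeaf E v = outdeg E v ≡ 0

  IsReticulation : Digraph n → Fin n → Set
  IsReticulation E v = indeg E v ≡ 2

  ReticulationEdge : Digraph n → Fin n → Fin n → Set
  ReticulationEdge E u v = Edge E u v × IsReticulation E v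

  TreeEdge : Digraph n → Fin n → Fin n → Set
  TreeEdge E u v = Edge E u v × ¬ IsReticulation E v

  -- Temporal labelling (FIDELITY: labels in ℚ instead of ℝ)
  IsTemporal : Digraph n → Set
  IsTemporal E = Σ (Fin n → ℚ) (λ t →
      (∀ u v → TreeEdge E u v → t u < t v)
    × (∀ u v → ReticulationEdge E u v → t u ≡ t v))

  SubgraphOf : Digraph n → Digraph n → Set
  SubgraphOf E' E = ∀ u v → Edge E' u v → Edge E u v

  IsRootedSpanningTree : Digraph n → Set
  IsRootedSpanningTree E' = Σ (Fin n) (λ ρ →
      indeg E' ρ ≡ 0
    × (∀ v → v ≢ ρ → indeg E' v ≡ 1)
    × (∀ v → Reach E' ρ v))

  IsTreeBased : Digraph n → Set
  IsTreeBased E = Σ (Digraph n) (λ E' →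
      SubgraphOf E' E
    × IsRootedSpanningTree E'
    × (∀ v → outdeg E' v ≡ 0 → IsLeaf E v))

  -- a directed path starting at u, given by the list of its later vertices
  ValidPath : Digraph n → Fin n → List (Fin n) → Set
  ValidPath E u []       = ⊤
  ValidPath E u (v ∷ vs) = Edge E u v × ValidPath E v vs

  endpoint : Fin n → List (Fin n) → Fin n
  endpoint u []       = u
  endpoint u (v ∷ vs) = endpoint v vs

  IsAntichain : Digraph n → {k : ℕ} → (Fin k → Fin n) → Set
  IsAntichain E a = ∀ i j → i ≢ j → ¬ Reach E (a i) (a j)

  AntichainToLeaf : Digraph n → Set
  AntichainToLeaf E = ∀ (k : ℕ) (a : Fin k → Fin n) →
      Injective _≡_ _≡_ a → IsAntichain E a →
      Σ (Fin k → List (Fin n)) (λ p →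
          (∀ i → ValidPath E (a i) (p i) × IsLeaf E (endpoint (a i) (p i)))
        × (∀ i j → i ≢ j → ∀ x → x ∈ (a i ∷ p i) → x ∈ (a j ∷ p j) → ⊥))

-- A spanning tree witnessing tree-basedness gives the disjoint paths directly: descend from each
-- antichain vertex inside the tree; two descents that met would make their starting points
-- comparable, since tree vertices have a single parent.
--
-- Conversely, a network is tree-based as soon as every non-leaf can choose one of its children
-- injectively: every vertex other than the root then keeps the edge from the non-leaf that chose
-- it, or any incoming edge. Such a choice is built by augmenting paths, as in Hall's theorem. When
-- augmentation from a fails, the vertices reached by alternating paths together with a form a set
-- A of non-leaves whose children, all reticulations, are fewer than the elements of A; and since
-- A is linked through shared reticulation children, all of it lies at the time of a. The
-- antichain-to-leaf property rules this out: the vertices of A not below its children form an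
-- antichain, and sending each vertex of A to the last child of A on its disjoint path to a leaf,
-- or on a path into it from those children (which runs through reticulations only), is injective.

module Submission where

open import Defs
open import Data.Bool using (Bool; true; false; not; _∧_)
import Data.Bool.Properties as Bool
open import Data.Empty using (⊥; ⊥-elim)
open import Data.Fin using (Fin; zero; suc)
open import Data.Fin.Properties using (_≟_; any?; injective⇒≤)
open import Data.List using (List; []; _∷_; _++_; length; map; filter; lookup; allFin; deduplicate)
open import Data.List.Properties using (filter-notAll; ∷-injectiveʳ; length-map)
open import Data.List.Membership.Propositional using (_∈_; _∉_; find)
open import Data.List.Membership.Propositional.Properties
  using (∈-allFin; ∈-filter⁺; ∈-filter⁻; ∈-lookup; ∈-++⁻; ∈-++⁺ʳ; ∈-map⁺; ∈-map⁻; ∈-deduplicate⁺; ∈-deduplicate⁻)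
open import Data.List.Relation.Unary.All as All using (All; []; _∷_)
open import Data.List.Relation.Unary.All.Properties using (¬Any⇒All¬; ++⁻ʳ)
open import Data.List.Relation.Unary.Any as Any using (Any; here; there; index)
open import Data.List.Relation.Unary.Any.Properties as Any using (lookup-index)
open import Data.List.Relation.Unary.Unique.Propositional using (Unique; []; _∷_)
import Data.List.Relation.Unary.Unique.Propositional.Properties as Unique
open import Data.List.Relation.Unary.Unique.DecPropositional.Properties using (deduplicate-!)
import Data.List.Membership.DecPropositional as DecMembership
open import Data.Nat as ℕ using (ℕ; zero; suc; _≤_; _<_; z≤n; s≤s)
import Data.Nat.Properties as ℕ
open import Data.Nat.Induction using (<-wellFounded)
open import Data.Rational as ℚ using (ℚ)
import Data.Rational.Properties as ℚ
open import Data.Product using (Σ; ∃; _×_; _,_; proj₁; proj₂)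
open import Data.Sum as Sum using (_⊎_; inj₁; inj₂)
open import Data.Unit using (tt)
open import Function using (_∘_; flip; id)
open import Induction.WellFounded using (Acc; acc; WellFounded)
open import Relation.Binary.PropositionalEquality using (_≡_; _≢_; refl; sym; trans; cong; subst; module ≡-Reasoning)
open import Relation.Binary.Construct.Closure.ReflexiveTransitive as Star using (Star; ε; _◅_; _◅◅_)
open import Relation.Binary.Construct.Closure.Transitive using (TransClosure; [_]; _∷_; _∷ʳ_)
open import Relation.Nullary using (¬_; Dec; yes; no; ¬?; contradiction)
open import Relation.Nullary.Decidable as Dec using (_×-dec_)
open import Relation.Unary using (Decidable)

module _ {A : Set} where

  ∈-∷⁻ : ∀ {xs : List A} {x y} → y ∈ x ∷ xs → y ≢ x → y ∈ xs
  ∈-∷⁻ (here y≡x) y≢x = ⊥-elim (y≢x y≡x)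
  ∈-∷⁻ (there y∈) _   = y∈

  length≡0⇒∉ : ∀ {xs : List A} {x} → length xs ≡ 0 → x ∉ xs
  length≡0⇒∉ {[]} _ ()

  ∉⇒length≡0 : ∀ {xs : List A} → (∀ {x} → x ∉ xs) → length xs ≡ 0
  ∉⇒length≡0 {[]} _ = refl
  ∉⇒length≡0 {x ∷ xs} ∉xs = ⊥-elim (∉xs (here refl))

  length≢0⇒∈ : ∀ {xs : List A} → length xs ≢ 0 → ∃ (_∈ xs)
  length≢0⇒∈ {[]} ≢0 = ⊥-elim (≢0 refl)
  length≢0⇒∈ {x ∷ xs} _ = x , here refl

  length≤1⇒≡ : ∀ {xs : List A} {x y} → length xs ≤ 1 → x ∈ xs → y ∈ xs → x ≡ y
  length≤1⇒≡ {_ ∷ []} _ (here refl) (here refl) = refl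
  length≤1⇒≡ {_ ∷ _ ∷ _} (s≤s ())

  length≡1 : ∀ {xs : List A} {x} → Unique xs → x ∈ xs → (∀ {y} → y ∈ xs → y ≡ x) → length xs ≡ 1
  length≡1 {_ ∷ []} _ _ _ = refl
  length≡1 {y ∷ z ∷ _} ((y≢z ∷ _) ∷ _) _ only =
    ⊥-elim (y≢z (trans (only (here refl)) (sym (only (there (here refl))))))

  lookup-injective : ∀ {xs : List A} {i j} → Unique xs → lookup xs i ≡ lookup xs j → i ≡ j
  lookup-injective {_ ∷ _} {zero} {zero} _ _ = refl
  lookup-injective {_ ∷ _} {zero} {suc j} (x≢ ∷ _) x≡ = ⊥-elim (All.lookup x≢ (∈-lookup j) x≡)
  lookup-injective {_ ∷ _} {suc i} {zero} (x≢ ∷ _) ≡x = ⊥-elim (All.lookup x≢ (∈-lookup i) (sym ≡x))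
  lookup-injective {_ ∷ _} {suc i} {suc j} (_ ∷ u) eq = cong suc (lookup-injective u eq)

  split-last : ∀ {P : A → Set} → Decidable P → ∀ {xs} → Any P xs →
               ∃ λ pre → ∃ λ w → ∃ λ post → xs ≡ pre ++ w ∷ post × P w × All (¬_ ∘ P) post
  split-last P? {x ∷ xs} p with Any.any? P? xs
  ... | yes ps = let pre , w , post , eq , pw , ¬post = split-last P? ps
                 in x ∷ pre , w , post , cong (x ∷_) eq , pw , ¬post
  split-last P? {x ∷ xs} (here px) | no ¬ps = [] , x , xs , refl , px , ¬Any⇒All¬ xs ¬ps
  split-last P? {x ∷ xs} (there ps) | no ¬ps = ⊥-elim (¬ps ps)

injective⇒length≤ : ∀ {A B : Set} {xs : List A} {ys : List B} (R : A → B → Set) → Unique xs →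
  (∀ {x} → x ∈ xs → ∃ λ y → y ∈ ys × R x y) →
  (∀ {x x′ y} → x ∈ xs → x′ ∈ xs → R x y → R x′ y → x ≡ x′) →
  length xs ≤ length ys
injective⇒length≤ {B = B} {xs} {ys} R unique image functional = injective⇒≤ index-injective
  where
  image-of : Fin (length xs) → B
  image-of i = proj₁ (image (∈-lookup i))

  image-of-∈ : ∀ i → image-of i ∈ ys
  image-of-∈ i = proj₁ (proj₂ (image (∈-lookup i)))

  R-image-of : ∀ i → R (lookup xs i) (image-of i)
  R-image-of i = proj₂ (proj₂ (image (∈-lookup i)))

  index-injective : ∀ {i j} → index (image-of-∈ i) ≡ index (image-of-∈ j) → i ≡ j
  index-injective {i} {j} eq = lookup-injective unique
    (functional (∈-lookup i) (∈-lookup j) (R-image-of i) (subst (R (lookup xs j)) same-image (R-image-of j)))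
    where
    open ≡-Reasoning
    same-image : image-of j ≡ image-of i
    same-image = begin
      image-of j                        ≡⟨ lookup-index (image-of-∈ j) ⟩
      lookup ys (index (image-of-∈ j))  ≡⟨ cong (lookup ys) (sym eq) ⟩
      lookup ys (index (image-of-∈ i))  ≡⟨ lookup-index (image-of-∈ i) ⟨
      image-of i                        ∎

-- The implicit argument of countTrue is an unused parameter of its module in Defs.
countTrue-map : ∀ {k} {A : Set} (f : A → Bool) xs →
                countTrue {k} (map f xs) ≡ length (filter (λ x → f x Bool.≟ true) xs)
countTrue-map f [] = refl
countTrue-map {k} f (x ∷ xs) with f x
... | true  = cong suc (countTrue-map {k} f xs)
... | false = countTrue-map {k} f xs

-- indeg E v and outdeg E u unfold to #true (λ u → E u v) and #true (E u).
#true : ∀ {m} → (Fin m → Bool) → ℕ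
#true {m} f = countTrue {m} (map f (allFin m))

module _ {m : ℕ} (f : Fin m → Bool) where

  private
    true? : Decidable (λ x → f x ≡ true)
    true? x = f x Bool.≟ true

    trues : List (Fin m)
    trues = filter true? (allFin m)

    #true≡length : #true f ≡ length trues
    #true≡length = countTrue-map {m} f (allFin m)

    ∈-trues : ∀ {x} → f x ≡ true → x ∈ trues
    ∈-trues fx = ∈-filter⁺ true? (∈-allFin _) fx

    trues-true : ∀ {x} → x ∈ trues → f x ≡ true
    trues-true x∈ = proj₂ (∈-filter⁻ true? {xs = allFin m} x∈)

  #true≡0⇒false : #true f ≡ 0 → ∀ {x} → f x ≢ true
  #true≡0⇒false #0 fx = length≡0⇒∉ (trans (sym #true≡length) #0) (∈-trues fx)

  false⇒#true≡0 : (∀ {x} → f x ≢ true) → #true f ≡ 0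
  false⇒#true≡0 none = trans #true≡length (∉⇒length≡0 (none ∘ trues-true))

  #true≢0⇒true : #true f ≢ 0 → ∃ λ x → f x ≡ true
  #true≢0⇒true #≢0 = let x , x∈ = length≢0⇒∈ (#≢0 ∘ trans #true≡length) in x , trues-true x∈

  #true≤1⇒unique : #true f ≤ 1 → ∀ {x y} → f x ≡ true → f y ≡ true → x ≡ y
  #true≤1⇒unique #≤1 fx fy = length≤1⇒≡ (subst (_≤ 1) #true≡length #≤1) (∈-trues fx) (∈-trues fy)

  unique⇒#true≡1 : ∀ {x} → f x ≡ true → (∀ {y} → f y ≡ true → y ≡ x) → #true f ≡ 1
  unique⇒#true≡1 fx only = trans #true≡length
    (length≡1 (Unique.filter⁺ true? {xs = allFin m} (Unique.allFin⁺ m)) (∈-trues fx) (only ∘ trues-true))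

-- Paths in finite acyclic digraphs

module _ {n : ℕ} {ℓ} {R : Fin n → Fin n → Set ℓ} where

  reverse⁺ : ∀ {x y} → TransClosure (flip R) x y → TransClosure R y x
  reverse⁺ [ r ]    = [ r ]
  reverse⁺ (r ∷ rs) = reverse⁺ rs ∷ʳ r

  -- The R⁺-predecessors of a predecessor y of v lie among those of v, but do not include y.
  acyclic⇒wellFounded : (∀ v → ¬ TransClosure R v v) → WellFounded R
  acyclic⇒wellFounded acyclic v = bounded (allFin n) (<-wellFounded _) (λ _ → ∈-allFin _)
    where
    bounded : ∀ xs → Acc _<_ (length xs) → ∀ {v} → (∀ {y} → TransClosure R y v → y ∈ xs) → Acc R v
    bounded xs (acc shorter) within = acc λ {y} yRv →
      bounded (filter (¬? ∘ (_≟ y)) xs)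
        (shorter (filter-notAll (¬? ∘ (_≟ y)) xs (Any.map (λ y≡x x≢y → x≢y (sym y≡x)) (within [ yRv ]))))
        (λ xR⁺y → ∈-filter⁺ (¬? ∘ (_≟ y)) (within (xR⁺y ∷ʳ yRv)) λ { refl → acyclic y xR⁺y })

module _ {n : ℕ} {E : Digraph n} where

  Reach⇒path : ∀ {u v} → Reach E u v → ∃ λ ps → ValidPath E u ps × endpoint u ps ≡ v
  Reach⇒path ε       = [] , tt , refl
  Reach⇒path (e ◅ r) = let ps , path , end = Reach⇒path r in _ ∷ ps , (e , path) , end

  path⇒Reach : ∀ {u} ps → ValidPath E u ps → ∀ {x} → x ∈ u ∷ ps → Reach E u x
  path⇒Reach _        _          (here refl) = ε
  path⇒Reach (_ ∷ ps) (e , path) (there x∈) = e ◅ path⇒Reach ps path x∈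

  path-suffix : ∀ {u ps w post} pre → u ∷ ps ≡ pre ++ w ∷ post → ValidPath E u ps →
                ValidPath E w post × endpoint w post ≡ endpoint u ps
  path-suffix []      refl path = path , refl
  path-suffix {ps = _ ∷ _} (_ ∷ pre) eq (_ , path) = path-suffix pre (∷-injectiveʳ eq) path
  path-suffix {ps = []} (_ ∷ []) () _
  path-suffix {ps = []} (_ ∷ _ ∷ _) () _

  path-mono : ∀ {E′ : Digraph n} → SubgraphOf E′ E → ∀ {u} ps → ValidPath E′ u ps → ValidPath E u ps
  path-mono _   []       _          = tt
  path-mono E′⊆E (_ ∷ ps) (e , path) = E′⊆E _ _ e , path-mono E′⊆E ps path

  outdeg≡1⇒unique-child : ∀ {u c c′} → outdeg E u ≡ 1 → Edge E u c → Edge E u c′ → c ≡ c′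
  outdeg≡1⇒unique-child {u} out≡1 = #true≤1⇒unique (E u) (ℕ.≤-reflexive out≡1)

  acyclic-mono : ∀ {E′ : Digraph n} → SubgraphOf E′ E → Acyclic E → Acyclic E′
  acyclic-mono {E′} E′⊆E acyclic v = acyclic v ∘ mono
    where
    mono : ∀ {x y} → TransClosure (Edge E′) x y → TransClosure (Edge E) x y
    mono [ e ]    = [ E′⊆E _ _ e ]
    mono (e ∷ es) = E′⊆E _ _ e ∷ mono es

  module _ (acyclic : Acyclic E) where

    parents-wellFounded : WellFounded (Edge E)
    parents-wellFounded = acyclic⇒wellFounded acyclic

    children-wellFounded : WellFounded (flip (Edge E))
    children-wellFounded = acyclic⇒wellFounded (λ v → acyclic v ∘ reverse⁺)

    reach? : ∀ u v → Dec (Reach E u v)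
    reach? u v = from (children-wellFounded u)
      where
      from : ∀ {u} → Acc (flip (Edge E)) u → Dec (Reach E u v)
      from {u} (acc below) with u ≟ v
      ... | yes refl = yes ε
      ... | no u≢v   =
        Dec.map′ (λ (_ , e , r) → e ◅ r) (λ { ε → ⊥-elim (u≢v refl) ; (e ◅ r) → _ , e , r }) (any? via)
        where
        via : ∀ c → Dec (Edge E u c × Reach E c v)
        via c with E u c Bool.≟ true
        ... | yes e = Dec.map′ (e ,_) proj₂ (from (below e))
        ... | no ¬e = no (¬e ∘ proj₁)

    path-to-leaf : ∀ v → ∃ λ ps → ValidPath E v ps × IsLeaf E (endpoint v ps)
    path-to-leaf v = descend (children-wellFounded v)
      where
      descend : ∀ {v} → Acc (flip (Edge E)) v → ∃ λ ps → ValidPath E v ps × IsLeaf E (endpoint v ps)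
      descend {v} (acc below) with outdeg E v ℕ.≟ 0
      ... | yes leaf = [] , tt , leaf
      ... | no ¬leaf = let c , e = #true≢0⇒true (E v) ¬leaf ; ps , path , leaf = descend (below e)
                       in c ∷ ps , (e , path) , leaf

-- Tree-based digraphs

module _ {A : Set} {R : A → A → Set} (deterministic : ∀ {x y z} → R x y → R x z → y ≡ z) where

  deterministic⇒comparable : ∀ {x u v} → Star R x u → Star R x v → Star R u v ⊎ Star R v u
  deterministic⇒comparable ε       q       = inj₁ q
  deterministic⇒comparable p       ε       = inj₂ p
  deterministic⇒comparable (r ◅ p) (s ◅ q) with deterministic r s
  ... | refl = deterministic⇒comparable p q

module _ {n : ℕ} {E : Digraph n} where

  indeg≤1⇒ancestors-comparable : (∀ v → indeg E v ≤ 1) → ∀ {u v x} → Reach E u x → Reach E v x →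
                                 Reach E u v ⊎ Reach E v u
  indeg≤1⇒ancestors-comparable indeg≤1 u⇝x v⇝x =
    Sum.swap (Sum.map unreverse unreverse
      (deterministic⇒comparable unique-parent (Star.reverse id u⇝x) (Star.reverse id v⇝x)))
    where
    unique-parent : ∀ {x y z} → flip (Edge E) x y → flip (Edge E) x z → y ≡ z
    unique-parent {x} = #true≤1⇒unique (λ u → E u x) (indeg≤1 x)

    unreverse : ∀ {x y} → Star (flip (Edge E)) x y → Reach E y x
    unreverse = Star.reverse id

treeBased⇒antichainToLeaf : ∀ {n} {E : Digraph n} → Acyclic E → IsTreeBased E → AntichainToLeaf E
treeBased⇒antichainToLeaf {n} {E} acyclic (T , T⊆E , (ρ , ρ-indeg , indeg≡1 , _) , T-leaf⇒leaf)
                          k a _ antichain =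
  paths , (λ i → path-mono T⊆E (paths i) (valid i) , T-leaf⇒leaf _ (leaf i)) , disjoint
  where
  descent : ∀ i → ∃ λ ps → ValidPath T (a i) ps × IsLeaf T (endpoint (a i) ps)
  descent i = path-to-leaf (acyclic-mono T⊆E acyclic) (a i)

  paths : Fin k → List (Fin n)
  paths = proj₁ ∘ descent

  valid : ∀ i → ValidPath T (a i) (paths i)
  valid = proj₁ ∘ proj₂ ∘ descent

  leaf : ∀ i → IsLeaf T (endpoint (a i) (paths i))
  leaf = proj₂ ∘ proj₂ ∘ descent

  indeg≤1 : ∀ v → indeg T v ≤ 1
  indeg≤1 v with v ≟ ρ
  ... | yes refl = ℕ.≤-trans (ℕ.≤-reflexive ρ-indeg) z≤n
  ... | no v≢ρ   = ℕ.≤-reflexive (indeg≡1 v v≢ρ)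

  disjoint : ∀ i j → i ≢ j → ∀ x → x ∈ a i ∷ paths i → x ∈ a j ∷ paths j → ⊥
  disjoint i j i≢j x x∈i x∈j
    with indeg≤1⇒ancestors-comparable indeg≤1 (path⇒Reach (paths i) (valid i) x∈i)
                                              (path⇒Reach (paths j) (valid j) x∈j)
  ... | inj₁ i⇝j = antichain i j i≢j (Star.map (T⊆E _ _) i⇝j)
  ... | inj₂ j⇝i = antichain j i (i≢j ∘ sym) (Star.map (T⊆E _ _) j⇝i)

module _ {n : ℕ} {E : Digraph n} (acyclic : Acyclic E) {r : Fin n} where

  module _ (par : Fin n → Fin n) (par-edge : ∀ {v} → v ≢ r → Edge E (par v) v)
           (par-onto : ∀ {u} → ¬ IsLeaf E u → ∃ λ v → v ≢ r × par v ≡ u) where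

    parentTree : Digraph n
    parentTree u v = not (Dec.does (v ≟ r)) ∧ Dec.does (par v ≟ u)

    parentTree-edge⁺ : ∀ {u v} → v ≢ r → par v ≡ u → Edge parentTree u v
    parentTree-edge⁺ {u} {v} v≢r par≡u with v ≟ r | par v ≟ u
    ... | yes v≡r | _         = ⊥-elim (v≢r v≡r)
    ... | no _    | yes _     = refl
    ... | no _    | no par≢u = ⊥-elim (par≢u par≡u)

    parentTree-edge⁻ : ∀ {u v} → Edge parentTree u v → v ≢ r × par v ≡ u
    parentTree-edge⁻ {u} {v} e with v ≟ r | par v ≟ u
    ... | no v≢r | yes par≡u = v≢r , par≡u

    parentChoice⇒treeBased : IsTreeBased E
    parentChoice⇒treeBased = parentTree , subgraph , (r , r-indeg , other-indeg , reach) , leaf⇒leaf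
      where
      subgraph : SubgraphOf parentTree E
      subgraph u v e with parentTree-edge⁻ e
      ... | v≢r , refl = par-edge v≢r

      r-indeg : indeg parentTree r ≡ 0
      r-indeg = false⇒#true≡0 (λ u → parentTree u r) λ e → proj₁ (parentTree-edge⁻ e) refl

      other-indeg : ∀ v → v ≢ r → indeg parentTree v ≡ 1
      other-indeg v v≢r =
        unique⇒#true≡1 (λ u → parentTree u v) (parentTree-edge⁺ v≢r refl) (sym ∘ proj₂ ∘ parentTree-edge⁻)

      climb : ∀ {v} → Acc (Edge E) v → Reach parentTree r v
      climb {v} (acc above) with v ≟ r
      ... | yes refl = ε
      ... | no v≢r   = climb (above (par-edge v≢r)) ◅◅ parentTree-edge⁺ v≢r refl ◅ ε

      reach : ∀ v → Reach parentTree r v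
      reach v = climb (parents-wellFounded acyclic v)

      leaf⇒leaf : ∀ u → IsLeaf parentTree u → IsLeaf E u
      leaf⇒leaf u leaf with outdeg E u ℕ.≟ 0
      ... | yes E-leaf = E-leaf
      ... | no ¬leaf   = let v , v≢r , par≡u = par-onto ¬leaf
                         in ⊥-elim (#true≡0⇒false (parentTree u) leaf (parentTree-edge⁺ v≢r par≡u))

  childChoice⇒treeBased : (∀ {u} → ¬ Edge E u r) → (∀ {v} → v ≢ r → ∃ λ u → Edge E u v) →
    (g : Fin n → Fin n) → (∀ {u} → ¬ IsLeaf E u → Edge E u (g u)) →
    (∀ {u v} → ¬ IsLeaf E u → ¬ IsLeaf E v → g u ≡ g v → u ≡ v) → IsTreeBased E
  childChoice⇒treeBased r-orphan has-parent g g-edge g-injective = parentChoice⇒treeBased par par-edge par-onto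
    where
    owner? : ∀ v → Dec (∃ λ u → ¬ IsLeaf E u × g u ≡ v)
    owner? v = any? λ u → ¬? (outdeg E u ℕ.≟ 0) ×-dec (g u ≟ v)

    some-parent : ∀ v → ∃ λ u → v ≢ r → Edge E u v
    some-parent v with v ≟ r
    ... | yes refl = r , λ r≢r → ⊥-elim (r≢r refl)
    ... | no v≢r   = let u , e = has-parent v≢r in u , λ _ → e

    par : Fin n → Fin n
    par v with owner? v
    ... | yes (u , _) = u
    ... | no _        = proj₁ (some-parent v)

    par-edge : ∀ {v} → v ≢ r → Edge E (par v) v
    par-edge {v} v≢r with owner? v
    ... | yes (u , ¬leaf , refl) = g-edge ¬leaf
    ... | no _                   = proj₂ (some-parent v) v≢r

    par-onto : ∀ {u} → ¬ IsLeaf E u → ∃ λ v → v ≢ r × par v ≡ u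
    par-onto {u} ¬leaf = g u , (λ { refl → r-orphan (g-edge ¬leaf) }) , owner
      where
      owner : par (g u) ≡ u
      owner with owner? (g u)
      ... | yes (u′ , ¬leaf′ , gu′≡gu) = g-injective ¬leaf′ ¬leaf gu′≡gu
      ... | no unowned                 = ⊥-elim (unowned (u , ¬leaf , refl))

-- Matching non-leaves to children

module _ {n : ℕ} where

  _∖_ : List (Fin n) → Fin n → List (Fin n)
  xs ∖ x = filter (¬? ∘ (_≟ x)) xs

  ∈-∖⁺ : ∀ {xs x y} → y ∈ xs → y ≢ x → y ∈ xs ∖ x
  ∈-∖⁺ = ∈-filter⁺ (¬? ∘ (_≟ _))

  ∈-∖⁻ : ∀ {xs x y} → y ∈ xs ∖ x → y ∈ xs × y ≢ x
  ∈-∖⁻ {xs} = ∈-filter⁻ (¬? ∘ (_≟ _)) {xs = xs}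

  ∖-shorter : ∀ {xs x} → x ∈ xs → length (xs ∖ x) < length xs
  ∖-shorter {xs} x∈xs = filter-notAll (¬? ∘ (_≟ _)) xs (Any.map (λ x≡y y≢x → y≢x (sym x≡y)) x∈xs)

  _[_↦_] : (Fin n → Fin n) → Fin n → Fin n → Fin n → Fin n
  (g [ a ↦ c ]) u with u ≟ a
  ... | yes _ = c
  ... | no _  = g u

module Matching {n : ℕ} (E : Digraph n) where

  open DecMembership (_≟_ {n}) using (_∈?_)

  record IsMatching (dom : List (Fin n)) (g : Fin n → Fin n) (ex : List (Fin n)) : Set where
    field
      edge      : ∀ {u} → u ∈ dom → Edge E u (g u)
      injective : ∀ {u v} → u ∈ dom → v ∈ dom → g u ≡ g v → u ≡ v
      avoids    : ∀ {u} → u ∈ dom → g u ∉ ex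

  open IsMatching public

  restrict : ∀ {dom dom′ g ex} → IsMatching dom g ex → (∀ {u} → u ∈ dom′ → u ∈ dom) → IsMatching dom′ g ex
  restrict m ⊆dom = record
    { edge = edge m ∘ ⊆dom ; injective = λ u∈ v∈ → injective m (⊆dom u∈) (⊆dom v∈) ; avoids = avoids m ∘ ⊆dom }

  exclude : ∀ {dom g ex c} → IsMatching dom g ex → (∀ {u} → u ∈ dom → g u ≢ c) → IsMatching dom g (c ∷ ex)
  exclude m unused = record
    { edge = edge m ; injective = injective m
    ; avoids = λ { u∈ (here gu≡c) → unused u∈ gu≡c ; u∈ (there gu∈ex) → avoids m u∈ gu∈ex } }

  extend : ∀ {dom g ex a c} → IsMatching dom g (c ∷ ex) → Edge E a c → c ∉ ex →
           IsMatching (a ∷ dom) (g [ a ↦ c ]) ex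
  extend {dom} {g} {ex} {a} {c} m e c∉ex = record { edge = edge′ ; injective = injective′ ; avoids = avoids′ }
    where
    edge′ : ∀ {u} → u ∈ a ∷ dom → Edge E u ((g [ a ↦ c ]) u)
    edge′ {u} u∈ with u ≟ a
    ... | yes refl = e
    ... | no u≢a   = edge m (∈-∷⁻ u∈ u≢a)

    avoids′ : ∀ {u} → u ∈ a ∷ dom → (g [ a ↦ c ]) u ∉ ex
    avoids′ {u} u∈ with u ≟ a
    ... | yes refl = c∉ex
    ... | no u≢a   = avoids m (∈-∷⁻ u∈ u≢a) ∘ there

    injective′ : ∀ {u v} → u ∈ a ∷ dom → v ∈ a ∷ dom → (g [ a ↦ c ]) u ≡ (g [ a ↦ c ]) v → u ≡ v
    injective′ {u} {v} u∈ v∈ eq with u ≟ a | v ≟ a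
    ... | yes refl | yes refl = refl
    ... | yes refl | no v≢a   = ⊥-elim (avoids m (∈-∷⁻ v∈ v≢a) (here (sym eq)))
    ... | no u≢a   | yes refl = ⊥-elim (avoids m (∈-∷⁻ u∈ u≢a) (here eq))
    ... | no u≢a   | no v≢a   = injective m (∈-∷⁻ u∈ u≢a) (∈-∷⁻ v∈ v≢a) eq

  CoParents : Fin n → Fin n → Set
  CoParents u v = u ≢ v × ∃ λ c → Edge E u c × Edge E v c

  Covered : List (Fin n) → (Fin n → Fin n) → List (Fin n) → Fin n → Set
  Covered ex g xs c = c ∈ ex ⊎ Any (λ x → g x ≡ c) xs

  -- The obstruction left by a failed augmenting-path search from a, `reached` being the vertices
  -- met on alternating paths; the last two fields record what the temporal argument needs about them.
  record Blocked (dom : List (Fin n)) (g : Fin n → Fin n) (ex : List (Fin n)) (a : Fin n) (cs : List (Fin n))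
    : Set where
    field
      reached         : List (Fin n)
      reached⊆dom     : ∀ {x} → x ∈ reached → x ∈ dom
      a-covered       : ∀ {c} → c ∈ cs → Edge E a c → Covered ex g reached c
      reached-covered : ∀ {x c} → x ∈ reached → Edge E x c → Covered ex g reached c
      shared          : ∀ {x} → x ∈ reached → ∃ λ y → y ≢ x × Edge E y (g x)
      linked          : ∀ {x} → x ∈ reached → Star CoParents a x

  open Blocked public

  blocked-[] : ∀ {dom g ex a} → Blocked dom g ex a []
  blocked-[] = record
    { reached = [] ; reached⊆dom = λ () ; a-covered = λ () ; reached-covered = λ ()
    ; shared = λ () ; linked = λ () }

  blocked-skip : ∀ {dom g ex a c cs} → (Edge E a c → c ∈ ex) → Blocked dom g ex a cs → Blocked dom g ex a (c ∷ cs)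
  blocked-skip unusable b = record
    { reached = reached b ; reached⊆dom = reached⊆dom b ; reached-covered = reached-covered b
    ; shared = shared b ; linked = linked b
    ; a-covered = λ { (here refl) e → inj₁ (unusable e) ; (there c∈cs) e → a-covered b c∈cs e } }

  blocked-via : ∀ {dom g ex a x cs} → IsMatching dom g ex → a ∉ dom → x ∈ dom → Edge E a (g x) →
                Blocked (dom ∖ x) g (g x ∷ ex) x (allFin n) → Blocked dom g ex a cs → Blocked dom g ex a (g x ∷ cs)
  blocked-via {dom} {g} {ex} {a} {x} {cs} m a∉dom x∈dom a→gx b₁ b₂ = record
    { reached = reached′ ; reached⊆dom = reached⊆dom′ ; a-covered = a-covered′
    ; reached-covered = reached-covered′ ; shared = shared′ ; linked = linked′ }
    where
    reached′ : List (Fin n)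
    reached′ = x ∷ reached b₁ ++ reached b₂

    x≢a : x ≢ a
    x≢a refl = a∉dom x∈dom

    a~x : CoParents a x
    a~x = x≢a ∘ sym , g x , a→gx , edge m x∈dom

    cases : ∀ {y} → y ∈ reached′ → y ≡ x ⊎ y ∈ reached b₁ ⊎ y ∈ reached b₂
    cases (here y≡x) = inj₁ y≡x
    cases (there y∈) = inj₂ (∈-++⁻ (reached b₁) y∈)

    lift₁ : ∀ {c} → Covered (g x ∷ ex) g (reached b₁) c → Covered ex g reached′ c
    lift₁ (inj₁ (here c≡gx)) = inj₂ (here (sym c≡gx))
    lift₁ (inj₁ (there c∈ex)) = inj₁ c∈ex
    lift₁ (inj₂ taken) = inj₂ (there (Any.++⁺ˡ taken))

    lift₂ : ∀ {c} → Covered ex g (reached b₂) c → Covered ex g reached′ c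
    lift₂ (inj₁ c∈ex) = inj₁ c∈ex
    lift₂ (inj₂ taken) = inj₂ (there (Any.++⁺ʳ (reached b₁) taken))

    reached⊆dom′ : ∀ {y} → y ∈ reached′ → y ∈ dom
    reached⊆dom′ y∈ with cases y∈
    ... | inj₁ refl       = x∈dom
    ... | inj₂ (inj₁ y∈₁) = proj₁ (∈-∖⁻ (reached⊆dom b₁ y∈₁))
    ... | inj₂ (inj₂ y∈₂) = reached⊆dom b₂ y∈₂

    a-covered′ : ∀ {c} → c ∈ g x ∷ cs → Edge E a c → Covered ex g reached′ c
    a-covered′ (here refl)  _ = inj₂ (here refl)
    a-covered′ (there c∈cs) e = lift₂ (a-covered b₂ c∈cs e)

    reached-covered′ : ∀ {y c} → y ∈ reached′ → Edge E y c → Covered ex g reached′ c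
    reached-covered′ y∈ e with cases y∈
    ... | inj₁ refl       = lift₁ (a-covered b₁ (∈-allFin _) e)
    ... | inj₂ (inj₁ y∈₁) = lift₁ (reached-covered b₁ y∈₁ e)
    ... | inj₂ (inj₂ y∈₂) = lift₂ (reached-covered b₂ y∈₂ e)

    shared′ : ∀ {y} → y ∈ reached′ → ∃ λ z → z ≢ y × Edge E z (g y)
    shared′ y∈ with cases y∈
    ... | inj₁ refl       = a , x≢a ∘ sym , a→gx
    ... | inj₂ (inj₁ y∈₁) = shared b₁ y∈₁
    ... | inj₂ (inj₂ y∈₂) = shared b₂ y∈₂

    linked′ : ∀ {y} → y ∈ reached′ → Star CoParents a y
    linked′ y∈ with cases y∈
    ... | inj₁ refl       = a~x ◅ ε
    ... | inj₂ (inj₁ y∈₁) = a~x ◅ linked b₁ y∈₁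
    ... | inj₂ (inj₂ y∈₂) = linked b₂ y∈₂

  augment : ∀ dom → Acc _<_ (length dom) → ∀ {g ex a} → IsMatching dom g ex → a ∉ dom →
            (∃ λ g′ → IsMatching (a ∷ dom) g′ ex) ⊎ Blocked dom g ex a (allFin n)
  augment dom (acc shorter) {g} {ex} {a} m a∉dom = try (allFin n)
    where
    taken? : ∀ c → Dec (∃ λ x → x ∈ dom × g x ≡ c)
    taken? c = any? λ x → (x ∈? dom) ×-dec (g x ≟ c)

    release : ∀ {x} → x ∈ dom → IsMatching (dom ∖ x) g (g x ∷ ex)
    release x∈dom = exclude (restrict m (proj₁ ∘ ∈-∖⁻ {xs = dom})) λ u∈ gu≡gx →
      let u∈dom , u≢x = ∈-∖⁻ {xs = dom} u∈ in u≢x (injective m u∈dom x∈dom gu≡gx)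

    x∉dom∖x : ∀ {x} → x ∉ dom ∖ x
    x∉dom∖x x∈ = proj₂ (∈-∖⁻ {xs = dom} x∈) refl

    reroute : ∀ {x u} → u ∈ a ∷ dom → u ∈ a ∷ x ∷ dom ∖ x
    reroute (here u≡a) = here u≡a
    reroute {x} {u} (there u∈dom) with u ≟ x
    ... | yes u≡x = there (here u≡x)
    ... | no u≢x  = there (there (∈-∖⁺ u∈dom u≢x))

    try : ∀ cs → (∃ λ g′ → IsMatching (a ∷ dom) g′ ex) ⊎ Blocked dom g ex a cs
    try [] = inj₂ blocked-[]
    try (c ∷ cs) with E a c Bool.≟ true | c ∈? ex
    ... | no ¬e | _        = Sum.map₂ (blocked-skip (⊥-elim ∘ ¬e)) (try cs)
    ... | yes _ | yes c∈ex = Sum.map₂ (blocked-skip (λ _ → c∈ex)) (try cs)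
    ... | yes e | no c∉ex with taken? c
    ...   | no free = inj₁ (_ , extend (exclude m λ u∈ gu≡c → free (_ , u∈ , gu≡c)) e c∉ex)
    -- c is taken by x: rematch x elsewhere, keeping c free for a.
    ...   | yes (x , x∈dom , refl) with augment (dom ∖ x) (shorter (∖-shorter x∈dom)) (release x∈dom) x∉dom∖x
    ...     | inj₁ (g′ , m′) = inj₁ (_ , restrict (extend m′ e c∉ex) reroute)
    ...     | inj₂ b         = Sum.map₂ (blocked-via m a∉dom x∈dom e b) (try cs)

-- Temporal phylogenetic networks

DisjointLeafPaths : ∀ {n k} → Digraph n → (Fin k → Fin n) → Set
DisjointLeafPaths {n} {k} E a = Σ (Fin k → List (Fin n)) λ p →
    (∀ i → ValidPath E (a i) (p i) × IsLeaf E (endpoint (a i) (p i)))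
  × (∀ i j → i ≢ j → ∀ x → x ∈ (a i ∷ p i) → x ∈ (a j ∷ p j) → ⊥)

AdmissibleDegrees : ∀ {n} → Digraph n → Fin n → Set
AdmissibleDegrees E v = (indeg E v ≡ 0 × outdeg E v ≡ 2) ⊎ (indeg E v ≡ 1 × outdeg E v ≡ 0)
            ⊎ (indeg E v ≡ 1 × outdeg E v ≡ 2) ⊎ (indeg E v ≡ 2 × outdeg E v ≡ 1)

module TemporalNetwork {n : ℕ} {E : Digraph n} (acyclic : Acyclic E) {r : Fin n}
  (r-indeg : indeg E r ≡ 0) (r-unique : ∀ v → indeg E v ≡ 0 → v ≡ r) (degrees : ∀ v → AdmissibleDegrees E v)
  (t : Fin n → ℚ) (tree-edge-time : ∀ u v → TreeEdge E u v → t u ℚ.< t v)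
  (retic-edge-time : ∀ u v → ReticulationEdge E u v → t u ≡ t v) where

  open Matching E
  open DecMembership (_≟_ {n}) using (_∈?_)

  reticulation⇒outdeg≡1 : ∀ {v} → IsReticulation E v → outdeg E v ≡ 1
  reticulation⇒outdeg≡1 {v} retic with degrees v
  ... | inj₁ (i , _)               = contradiction (trans (sym i) retic) λ ()
  ... | inj₂ (inj₁ (i , _))        = contradiction (trans (sym i) retic) λ ()
  ... | inj₂ (inj₂ (inj₁ (i , _))) = contradiction (trans (sym i) retic) λ ()
  ... | inj₂ (inj₂ (inj₂ (_ , o))) = o

  ¬reticulation⇒indeg≤1 : ∀ {v} → ¬ IsReticulation E v → indeg E v ≤ 1
  ¬reticulation⇒indeg≤1 {v} ¬retic with degrees v
  ... | inj₁ (i , _)               = ℕ.≤-trans (ℕ.≤-reflexive i) z≤n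
  ... | inj₂ (inj₁ (i , _))        = ℕ.≤-reflexive i
  ... | inj₂ (inj₂ (inj₁ (i , _))) = ℕ.≤-reflexive i
  ... | inj₂ (inj₂ (inj₂ (i , _))) = ⊥-elim (¬retic i)

  two-parents⇒reticulation : ∀ {u v c} → Edge E u c → Edge E v c → u ≢ v → IsReticulation E c
  two-parents⇒reticulation {c = c} u→c v→c u≢v with indeg E c ℕ.≟ 2
  ... | yes retic = retic
  ... | no ¬retic = ⊥-elim (u≢v (#true≤1⇒unique (λ x → E x c) (¬reticulation⇒indeg≤1 ¬retic) u→c v→c))

  edge-time : ∀ {u v} → Edge E u v → t u ℚ.≤ t v
  edge-time {u} {v} e with indeg E v ℕ.≟ 2
  ... | yes retic = ℚ.≤-reflexive (retic-edge-time u v (e , retic))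
  ... | no ¬retic = ℚ.<⇒≤ (tree-edge-time u v (e , ¬retic))

  path-time : ∀ {u} ps → ValidPath E u ps → t u ℚ.≤ t (endpoint u ps)
  path-time []       _          = ℚ.≤-refl
  path-time (_ ∷ ps) (e , path) = ℚ.≤-trans (edge-time e) (path-time ps path)

  level-path⇒reticulations : ∀ {u} ps → ValidPath E u ps → t u ≡ t (endpoint u ps) → All (IsReticulation E) ps
  level-path⇒reticulations []       _          _     = []
  level-path⇒reticulations {u} (v ∷ ps) (e , path) level with indeg E v ℕ.≟ 2
  ... | yes retic = retic ∷ level-path⇒reticulations ps path (trans (sym (retic-edge-time u v (e , retic))) level)
  ... | no ¬retic = ⊥-elim (ℚ.<-irrefl level (ℚ.<-≤-trans (tree-edge-time u v (e , ¬retic)) (path-time ps path)))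

  coParents-time : ∀ {u v} → Star CoParents u v → t u ≡ t v
  coParents-time ε = refl
  coParents-time ((u≢w , c , u→c , w→c) ◅ rest) =
    let retic = two-parents⇒reticulation u→c w→c u≢w
    in trans (retic-edge-time _ _ (u→c , retic))
             (trans (sym (retic-edge-time _ _ (w→c , retic))) (coParents-time rest))

  -- The vertices of A not reachable from W form an antichain S. Each u ∈ A is sent to the last
  -- W-vertex on its disjoint path to a leaf if u ∈ S, and otherwise on a path from W to u; in the
  -- latter case the rest of the path is forced, all its vertices having out-degree one.
  module _ (atl : AntichainToLeaf E) {A W : List (Fin n)} {τ : ℚ} (A-unique : Unique A)
           (A-nonleaf : ∀ {u} → u ∈ A → ¬ IsLeaf E u) (A-time : ∀ {u} → u ∈ A → t u ≡ τ)
           (W-retic : ∀ {w} → w ∈ W → IsReticulation E w) (W-time : ∀ {w} → w ∈ W → t w ≡ τ)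
           (A-children : ∀ {u c} → u ∈ A → Edge E u c → c ∈ W) where

    private
      FedByW : Fin n → Set
      FedByW v = ∃ λ w → w ∈ W × Reach E w v

      fedByW? : ∀ v → Dec (FedByW v)
      fedByW? v = any? λ w → (w ∈? W) ×-dec reach? acyclic w v

      S : List (Fin n)
      S = filter (¬? ∘ fedByW?) A

      S⊆A : ∀ i → lookup S i ∈ A
      S⊆A i = proj₁ (∈-filter⁻ (¬? ∘ fedByW?) {xs = A} (∈-lookup i))

      S-unique : Unique S
      S-unique = Unique.filter⁺ (¬? ∘ fedByW?) A-unique

      S-unfed : ∀ j → ¬ FedByW (lookup S j)
      S-unfed j = proj₂ (∈-filter⁻ (¬? ∘ fedByW?) {xs = A} (∈-lookup j))

      leave-A : ∀ {u v} → u ∈ A → Reach E u v → u ≡ v ⊎ FedByW v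
      leave-A _   ε       = inj₁ refl
      leave-A u∈A (e ◅ r) = inj₂ (_ , A-children u∈A e , r)

      S-antichain : IsAntichain E (lookup S)
      S-antichain i j i≢j r with leave-A (S⊆A i) r
      ... | inj₁ same = i≢j (lookup-injective S-unique same)
      ... | inj₂ fed  = S-unfed j fed

      disjoint-paths : DisjointLeafPaths E (lookup S)
      disjoint-paths = atl (length S) (lookup S) (lookup-injective S-unique) S-antichain

      path : Fin (length S) → List (Fin n)
      path = proj₁ disjoint-paths

      path-valid : ∀ i → ValidPath E (lookup S i) (path i)
      path-valid i = proj₁ (proj₁ (proj₂ disjoint-paths) i)

      path-leaf : ∀ i → IsLeaf E (endpoint (lookup S i) (path i))
      path-leaf i = proj₂ (proj₁ (proj₂ disjoint-paths) i)

      path-disjoint : ∀ i j → i ≢ j → ∀ x → x ∈ lookup S i ∷ path i → x ∈ lookup S j ∷ path j → ⊥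
      path-disjoint = proj₂ (proj₂ disjoint-paths)

      Forced : Fin n → Fin n → Set
      Forced x y = Edge E x y × outdeg E x ≡ 1 × x ∉ A

      forced-unique : ∀ {w u v} → Star Forced w u → Star Forced w v → u ∈ A → v ∈ A → u ≡ v
      forced-unique ε ε _ _ = refl
      forced-unique ε ((_ , _ , w∉A) ◅ _) w∈A _ = ⊥-elim (w∉A w∈A)
      forced-unique ((_ , _ , w∉A) ◅ _) ε _ w∈A = ⊥-elim (w∉A w∈A)
      forced-unique ((e , out≡1 , _) ◅ p) ((e′ , _ , _) ◅ q) u∈A v∈A
        with outdeg≡1⇒unique-child {E = E} out≡1 e e′
      ... | refl = forced-unique p q u∈A v∈A

      forced-into-A⇒¬escape : ∀ {w u} → Star Forced w u → u ∈ A → ∀ ps → ValidPath E w ps →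
                              IsLeaf E (endpoint w ps) → All (_∉ W) ps → ⊥
      forced-into-A⇒¬escape ε u∈A [] _ leaf _ = A-nonleaf u∈A leaf
      forced-into-A⇒¬escape ε u∈A (_ ∷ _) (e , _) _ (c∉W ∷ _) = c∉W (A-children u∈A e)
      forced-into-A⇒¬escape ((_ , out≡1 , _) ◅ _) _ [] _ leaf _ = contradiction (trans (sym out≡1) leaf) λ ()
      forced-into-A⇒¬escape ((e , out≡1 , _) ◅ p) u∈A (_ ∷ ps) (e′ , path) leaf (_ ∷ ∉W)
        with outdeg≡1⇒unique-child {E = E} out≡1 e e′
      ... | refl = forced-into-A⇒¬escape p u∈A ps path leaf ∉W

      record Escape (i : Fin (length S)) (w : Fin n) : Set where
        field
          on-path : w ∈ lookup S i ∷ path i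
          rest    : List (Fin n)
          valid   : ValidPath E w rest
          leaf    : IsLeaf E (endpoint w rest)
          avoids  : All (_∉ W) rest

      Exit : Fin n → Fin n → Set
      Exit u w = Star Forced w u ⊎ ∃ λ i → lookup S i ≡ u × Escape i w

      exit-injective : ∀ {u v w} → u ∈ A → v ∈ A → Exit u w → Exit v w → u ≡ v
      exit-injective u∈A v∈A (inj₁ p) (inj₁ q) = forced-unique p q u∈A v∈A
      exit-injective u∈A _ (inj₁ p) (inj₂ (_ , _ , esc)) =
        ⊥-elim (forced-into-A⇒¬escape p u∈A _ (Escape.valid esc) (Escape.leaf esc) (Escape.avoids esc))
      exit-injective _ v∈A (inj₂ (_ , _ , esc)) (inj₁ q) =
        ⊥-elim (forced-into-A⇒¬escape q v∈A _ (Escape.valid esc) (Escape.leaf esc) (Escape.avoids esc))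
      exit-injective _ _ (inj₂ (i , refl , esc)) (inj₂ (j , refl , esc′)) with i ≟ j
      ... | yes refl = refl
      ... | no i≢j   = ⊥-elim (path-disjoint i j i≢j _ (Escape.on-path esc) (Escape.on-path esc′))

      first-step-in-W : ∀ {u} ps → u ∈ A → ValidPath E u ps → IsLeaf E (endpoint u ps) → Any (_∈ W) (u ∷ ps)
      first-step-in-W []      u∈A _       leaf = ⊥-elim (A-nonleaf u∈A leaf)
      first-step-in-W (_ ∷ _) u∈A (e , _) _    = there (here (A-children u∈A e))

      escape : ∀ i → ∃ λ w → w ∈ W × Escape i w
      escape i =
        let pre , w , rest , split , w∈W , avoids =
              split-last (_∈? W) (first-step-in-W (path i) (S⊆A i) (path-valid i) (path-leaf i))
            valid , end = path-suffix pre split (path-valid i)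
        in w , w∈W , record
          { on-path = subst (w ∈_) (sym split) (∈-++⁺ʳ pre (here refl))
          ; rest = rest ; valid = valid ; leaf = subst (IsLeaf E) (sym end) (path-leaf i) ; avoids = avoids }

      forced : ∀ {w} ps → ValidPath E w ps → All (IsReticulation E) (w ∷ ps) → All (_∉ W) ps →
               Star Forced w (endpoint w ps)
      forced []       _          _              _              = ε
      forced (_ ∷ ps) (e , path) (retic ∷ rets) (c∉W ∷ avoids) =
        (e , reticulation⇒outdeg≡1 retic , λ w∈A → c∉W (A-children w∈A e)) ◅ forced ps path rets avoids

      -- A path from W into A stays at time τ, so it runs through reticulations only.
      fed-exit : ∀ {u} → u ∈ A → FedByW u → ∃ λ w → w ∈ W × Star Forced w u
      fed-exit u∈A (w₀ , w₀∈W , w₀⇝u) =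
        let ps , path , end = Reach⇒path w₀⇝u
            level = trans (W-time w₀∈W) (sym (trans (cong t end) (A-time u∈A)))
            rets = W-retic w₀∈W ∷ level-path⇒reticulations ps path level
            pre , w , rest , split , w∈W , avoids = split-last (_∈? W) (here w₀∈W)
            valid , end′ = path-suffix pre split path
        in w , w∈W , subst (Star Forced w) (trans end′ end)
                       (forced rest valid (++⁻ʳ pre (subst (All (IsReticulation E)) split rets)) avoids)

      exit : ∀ {u} → u ∈ A → ∃ λ w → w ∈ W × Exit u w
      exit {u} u∈A with fedByW? u
      ... | yes fed  = let w , w∈W , p = fed-exit u∈A fed in w , w∈W , inj₁ p
      ... | no unfed = let u∈S = ∈-filter⁺ (¬? ∘ fedByW?) u∈A unfed ; w , w∈W , esc = escape (index u∈S)
                       in w , w∈W , inj₂ (index u∈S , sym (lookup-index u∈S) , esc)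

    hall-inequality : length A ≤ length W
    hall-inequality = injective⇒length≤ Exit A-unique exit exit-injective

  module _ (atl : AntichainToLeaf E) where

    blocked⇒⊥ : ∀ {dom g a} → IsMatching dom g [] → a ∉ dom → ¬ IsLeaf E a → ¬ Blocked dom g [] a (allFin n)
    blocked⇒⊥ {dom} {g} {a} m a∉dom ¬leaf b =
      ℕ.1+n≰n (ℕ.≤-trans (hall-inequality atl A-unique A-nonleaf A-time W-retic W-time A-children)
                         (ℕ.≤-reflexive (length-map g R)))
      where
      R : List (Fin n)
      R = deduplicate _≟_ (reached b)

      W : List (Fin n)
      W = map g R

      R⊆reached : ∀ {x} → x ∈ R → x ∈ reached b
      R⊆reached = ∈-deduplicate⁻ _≟_ (reached b)

      R⊆dom : ∀ {x} → x ∈ R → x ∈ dom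
      R⊆dom = reached⊆dom b ∘ R⊆reached

      A-unique : Unique (a ∷ R)
      A-unique = All.tabulate (λ x∈R a≡x → a∉dom (subst (_∈ dom) (sym a≡x) (R⊆dom x∈R)))
               ∷ deduplicate-! _≟_ (reached b)

      A-nonleaf : ∀ {u} → u ∈ a ∷ R → ¬ IsLeaf E u
      A-nonleaf (here refl) = ¬leaf
      A-nonleaf {u} (there u∈R) leaf = #true≡0⇒false (E u) leaf (edge m (R⊆dom u∈R))

      A-time : ∀ {u} → u ∈ a ∷ R → t u ≡ t a
      A-time (here refl) = refl
      A-time (there u∈R) = sym (coParents-time (linked b (R⊆reached u∈R)))

      W-member : ∀ {w} → w ∈ W → ∃ λ x → x ∈ reached b × w ≡ g x
      W-member w∈W = let x , x∈R , w≡gx = ∈-map⁻ g w∈W in x , R⊆reached x∈R , w≡gx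

      W-retic : ∀ {w} → w ∈ W → IsReticulation E w
      W-retic w∈W with W-member w∈W
      ... | x , x∈ , refl = let y , y≢x , y→gx = shared b x∈
                            in two-parents⇒reticulation y→gx (edge m (reached⊆dom b x∈)) y≢x

      W-time : ∀ {w} → w ∈ W → t w ≡ t a
      W-time w∈W with W-member w∈W
      ... | x , x∈ , refl = trans (sym (retic-edge-time _ _ (edge m (reached⊆dom b x∈) , W-retic w∈W)))
                                  (sym (coParents-time (linked b x∈)))

      covered⇒∈W : ∀ {c} → Covered [] g (reached b) c → c ∈ W
      covered⇒∈W (inj₂ taken) = let x , x∈ , gx≡c = find taken in
        subst (_∈ W) gx≡c (∈-map⁺ g (∈-deduplicate⁺ _≟_ x∈))

      A-children : ∀ {u c} → u ∈ a ∷ R → Edge E u c → c ∈ W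
      A-children (here refl) e = covered⇒∈W (a-covered b (∈-allFin _) e)
      A-children (there u∈R) e = covered⇒∈W (reached-covered b (R⊆reached u∈R) e)

    match-non-leaves : ∀ vs → ∃ λ dom → ∃ λ g → IsMatching dom g [] × (∀ {v} → v ∈ vs → ¬ IsLeaf E v → v ∈ dom)
    match-non-leaves [] = [] , id , record { edge = λ () ; injective = λ () ; avoids = λ () } , λ ()
    match-non-leaves (v ∷ vs) with match-non-leaves vs
    ... | dom , g , m , covers with v ∈? dom | outdeg E v ℕ.≟ 0
    ...   | yes v∈dom | _ = dom , g , m , λ { (here refl) _ → v∈dom ; (there v∈) → covers v∈ }
    ...   | no _ | yes leaf = dom , g , m , λ { (here refl) ¬leaf → ⊥-elim (¬leaf leaf) ; (there v∈) → covers v∈ }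
    ...   | no v∉dom | no ¬leaf with augment dom (<-wellFounded _) m v∉dom
    ...     | inj₁ (g′ , m′) =
      v ∷ dom , g′ , m′ , λ { (here refl) _ → here refl ; (there v∈) ¬leaf → there (covers v∈ ¬leaf) }
    ...     | inj₂ b        = ⊥-elim (blocked⇒⊥ m v∉dom ¬leaf b)

    antichainToLeaf⇒treeBased : IsTreeBased E
    antichainToLeaf⇒treeBased with match-non-leaves (allFin n)
    ... | dom , g , m , covers =
      childChoice⇒treeBased acyclic (#true≡0⇒false (λ u → E u r) r-indeg)
        (λ {v} v≢r → #true≢0⇒true (λ u → E u v) (v≢r ∘ r-unique v)) g
        (edge m ∘ matched) (λ ¬leaf-u ¬leaf-v → injective m (matched ¬leaf-u) (matched ¬leaf-v))
      where
      matched : ∀ {u} → ¬ IsLeaf E u → u ∈ dom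
      matched = covers (∈-allFin _)

module _ {n : ℕ} {E : Digraph n} (no-edges : ∀ u v → E u v ≡ false) where

  edgeless-no-edge : ∀ {u v} → ¬ Edge E u v
  edgeless-no-edge {u} {v} e with trans (sym e) (no-edges u v)
  ... | ()

  edgeless-acyclic : Acyclic E
  edgeless-acyclic _ [ e ]   = edgeless-no-edge e
  edgeless-acyclic _ (e ∷ _) = edgeless-no-edge e

edgeless-treeBased : {E : Digraph 1} → (∀ u v → E u v ≡ false) → IsTreeBased E
edgeless-treeBased {E} no-edges = parentChoice⇒treeBased (edgeless-acyclic no-edges) {r = zero} id
  (λ { {zero} 0≢0 → ⊥-elim (0≢0 refl) })
  (λ {u} ¬leaf → ⊥-elim (¬leaf (false⇒#true≡0 (E u) (edgeless-no-edge no-edges))))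

theorem3 : (n : ℕ) (E : Digraph n) → IsPhyloNetwork E → IsTemporal E →
    (IsTreeBased E → AntichainToLeaf E) × (AntichainToLeaf E → IsTreeBased E)
theorem3 n E (inj₁ (refl , no-edges)) _ =
  treeBased⇒antichainToLeaf (edgeless-acyclic no-edges) , λ _ → edgeless-treeBased no-edges
theorem3 n E (inj₂ (acyclic , r , r-indeg , _ , r-unique , degrees)) (t , tree-edge-time , retic-edge-time) =
  treeBased⇒antichainToLeaf acyclic ,
  TemporalNetwork.antichainToLeaf⇒treeBased acyclic r-indeg r-unique degrees t tree-edge-time retic-edge-time
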